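{- Let $T^{\le}$ be the homotopy type of an SNBC walk in some graph. Then either $T$ is a bouquet of a single whole-loop (i.e. $T^{\le}$ is the homotopy type of a cycle), or $\mathrm{ord}(T)\ge1$.
   Context: A (finite) graph $G$ consists of finite sets $V_G,E^{\mathrm{dir}}_G$, maps $h_G,t_G\colon E^{\mathrm{dir}}_G\to V_G$ and an involution $\iota_G$ with $t_G\iota_G=h_G$; edges are $\iota_G$-orbits (fixed points are half-loops; size-two orbits with $h_Ge=t_Ge$ are whole-loops); degree of $v$ is $\#\{e:t_Ge=v\}$; $\mathrm{ord}(G)=\#E_G-\#V_G$. A walk $(v_0,e_1,\dots,e_k,v_k)$ has $t_Ge_i=v_{i-1}$, $h_Ge_i=v_i$; it is non-backtracking if $e_{i+1}\ne\iota_Ge_i$, and SNBC if moreover $k\ge1$, $v_k=v_0$, $e_1\ne\iota_Ge_k$. Its visited subgraph $S$ is the smallest subgraph containing its vertices and directed edges, ordered by first-encountered order (vertices and edges ordered by first occurrence, each edge oriented in the direction first traversed). A bead of $S$ is a vertex of degree $2$ not incident to a self-loop. The reduction of the walk is the ordered graph obtained from $S$ by suppressing all beads other than the first and last vertex of the walk: its vertices are the remaining vertices, its directed edges are the non-backtracking walks in $S$ between remaining vertices all of whose intermediate vertices are suppressed beads, with head/tail the endpoints and involution given by reversing the walk, with the induced ordering. The walk is of homotopy type $T^\le$ if $T^\le$ is isomorphic, as an ordered graph, to its reduction. A bouquet of a single whole-loop is the graph with one vertex and one whole-loop. -}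

module Defs where

open import Data.Nat using (ℕ; zero; suc; _≤?_; _≤_)
open import Data.Fin using (Fin; toℕ) renaming (zero to fzero; suc to fsuc)
open import Data.Fin.Properties using () renaming (_≟_ to _≟ᶠ_)
open import Data.List using (List; []; _∷_; length; filter; map; reverse; allFin)
open import Data.List.Relation.Unary.Any using (Any)
open import Data.List.Relation.Unary.All using (All)
open import Data.List.Membership.Propositional using (_∈_)
import Data.List.Membership.DecPropositional as DecMem
open import Data.Integer using (ℤ; +_; _-_)
open import Data.Product using (Σ; Σ-syntax; _×_; _,_)
open import Data.Sum using (_⊎_)
open import Data.Unit using (⊤)
open import Data.Empty using (⊥)
open import Relation.Nullary using (¬_; Dec)
open import Relation.Nullary.Decidable using (_×-dec_; _⊎-dec_)
open import Relation.Binary.PropositionalEquality using (_≡_; _≢_)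

record Graph : Set where
  field
    nV nD  : ℕ
    hd tl  : Fin nD → Fin nV
    ι      : Fin nD → Fin nD
    ι-invol : ∀ e → ι (ι e) ≡ e
    tl-ι    : ∀ e → tl (ι e) ≡ hd e

open Graph public

-- Number of (undirected) edges = number of ι-orbits.  Each orbit {e, ι e}
-- has exactly one element e with toℕ e ≤ toℕ (ι e); we count these.
numEdges : Graph → ℕ
numEdges G = length (filter (λ e → toℕ e ≤? toℕ (ι G e)) (allFin (nD G)))

ord : Graph → ℤ
ord G = (+ numEdges G) - (+ nV G)

record GraphIso (G H : Graph) : Set where
  field
    fV : Fin (nV G) → Fin (nV H)
    gV : Fin (nV H) → Fin (nV G)
    fD : Fin (nD G) → Fin (nD H)
    gD : Fin (nD H) → Fin (nD G)
    gfV : ∀ x → gV (fV x) ≡ x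
    fgV : ∀ y → fV (gV y) ≡ y
    gfD : ∀ x → gD (fD x) ≡ x
    fgD : ∀ y → fD (gD y) ≡ y
    f-hd : ∀ e → fV (hd G e) ≡ hd H (fD e)
    f-tl : ∀ e → fV (tl G e) ≡ tl H (fD e)
    f-ι  : ∀ e → fD (ι G e) ≡ ι H (fD e)

-- The bouquet of a single whole-loop: one vertex, one edge consisting of
-- two directed edges swapped by ι, both with head = tail = the vertex.
swap2 : Fin 2 → Fin 2
swap2 fzero = fsuc fzero
swap2 (fsuc fzero) = fzero

swap2-invol : ∀ e → swap2 (swap2 e) ≡ e
swap2-invol fzero = _≡_.refl
swap2-invol (fsuc fzero) = _≡_.refl

bouquet : Graph
bouquet = record
  { nV = 1 ; nD = 2
  ; hd = λ _ → fzero ; tl = λ _ → fzero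
  ; ι = swap2
  ; ι-invol = swap2-invol
  ; tl-ι = λ _ → _≡_.refl }

-- Walks in G, given by a start vertex and the list of directed edges
-- (the vertices v₁ … v_k are the heads of the edges).

module _ (G : Graph) where

  IsWalk : Fin (nV G) → List (Fin (nD G)) → Set
  IsWalk v [] = ⊤
  IsWalk v (d ∷ ds) = (tl G d ≡ v) × IsWalk (hd G d) ds

  endV : Fin (nV G) → List (Fin (nD G)) → Fin (nV G)
  endV v [] = v
  endV v (d ∷ ds) = endV (hd G d) ds

  NonBacktracking : List (Fin (nD G)) → Set
  NonBacktracking [] = ⊤
  NonBacktracking (d ∷ []) = ⊤
  NonBacktracking (d ∷ d′ ∷ ds) = (d′ ≢ ι G d) × NonBacktracking (d′ ∷ ds)

  lastOf : Fin (nD G) → List (Fin (nD G)) → Fin (nD G)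
  lastOf d [] = d
  lastOf d (d′ ∷ ds) = lastOf d′ ds

  innerV : List (Fin (nD G)) → List (Fin (nV G))
  innerV [] = []
  innerV (d ∷ []) = []
  innerV (d ∷ d′ ∷ ds) = hd G d ∷ innerV (d′ ∷ ds)

  IsSNBC : Fin (nV G) → List (Fin (nD G)) → Set
  IsSNBC v [] = ⊥
  IsSNBC v (d ∷ ds) =
    IsWalk v (d ∷ ds) × NonBacktracking (d ∷ ds) ×
    (endV v (d ∷ ds) ≡ v) × (d ≢ ι G (lastOf d ds))

module Reduction (G : Graph) (v₀ : Fin (nV G)) (ds : List (Fin (nD G))) where

  open DecMem (_≟ᶠ_ {nD G}) using (_∈?_)

  vEnd : Fin (nV G)
  vEnd = endV G v₀ ds

  VS : Fin (nV G) → Set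
  VS x = (x ≡ v₀) ⊎ Any (λ d → hd G d ≡ x) ds

  DS : Fin (nD G) → Set
  DS d = (d ∈ ds) ⊎ (ι G d ∈ ds)

  DS? : ∀ d → Dec (DS d)
  DS? d = (d ∈? ds) ⊎-dec (ι G d ∈? ds)

  degS : Fin (nV G) → ℕ
  degS x = length (filter (λ d → DS? d ×-dec (tl G d ≟ᶠ x)) (allFin (nD G)))

  HasSelfLoop : Fin (nV G) → Set
  HasSelfLoop x = Σ[ d ∈ Fin (nD G) ] DS d × (tl G d ≡ x) × (hd G d ≡ x)

  Bead : Fin (nV G) → Set
  Bead x = (degS x ≡ 2) × ¬ HasSelfLoop x

  SuppressedBead : Fin (nV G) → Set
  SuppressedBead x = Bead x × (x ≢ v₀) × (x ≢ vEnd)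

  Remaining : Fin (nV G) → Set
  Remaining x = VS x × ¬ SuppressedBead x

  -- directed edges of the reduction: non-backtracking walks (of length ≥ 1)
  -- in S from a remaining vertex u to a remaining vertex, all of whose
  -- intermediate vertices are suppressed beads.
  RedEdge : Fin (nV G) → List (Fin (nD G)) → Set
  RedEdge u [] = ⊥
  RedEdge u (p ∷ ps) =
    IsWalk G u (p ∷ ps) × All DS (p ∷ ps) × NonBacktracking G (p ∷ ps) ×
    Remaining u × Remaining (endV G u (p ∷ ps)) ×
    All SuppressedBead (innerV G (p ∷ ps))

  revWalk : List (Fin (nD G)) → List (Fin (nD G))
  revWalk ps = reverse (map (ι G) ps)

  record IsoToReduction (T : Graph) : Set where
    field
      fV      : Fin (nV T) → Fin (nV G)
      fV-rem  : ∀ x → Remaining (fV x)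
      fV-inj  : ∀ x y → fV x ≡ fV y → x ≡ y
      fV-surj : ∀ y → Remaining y → Σ[ x ∈ Fin (nV T) ] fV x ≡ y
      fD      : Fin (nD T) → List (Fin (nD G))
      fD-red  : ∀ e → RedEdge (fV (tl T e)) (fD e)
      fD-hd   : ∀ e → endV G (fV (tl T e)) (fD e) ≡ fV (hd T e)
      fD-inj  : ∀ e e′ → fD e ≡ fD e′ → e ≡ e′
      fD-surj : ∀ u ps → RedEdge u ps → Σ[ e ∈ Fin (nD T) ] fD e ≡ ps
      fD-ι    : ∀ e → fD (ι T e) ≡ revWalk (fD e)

-- T is (the underlying graph of) the homotopy type of the walk (v₀, ds) in G
HomotopyType : (G : Graph) → Fin (nV G) → List (Fin (nD G)) → Graph → Set
HomotopyType G v₀ ds T = Reduction.IsoToReduction G v₀ ds T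

-- Every vertex of the visited subgraph S of an SNBC walk has two distinct outgoing edges in S
-- (non-backtracking inside the walk, the strict condition at the base point), and every edge of S
-- leaving a vertex of the reduction starts a directed edge of the reduction.  Hence every vertex of
-- T has degree at least 2, and a loopless vertex of degree 2 can only be the base point, since any
-- other one would be a suppressed bead.  Double counting gives 2·#V ≤ ∑ deg = #E^dir ≤ 2·#E, with
-- the first inequality strict at a vertex of degree ≥ 3 and the second strict at a half-loop; so
-- ord T ≥ 1 unless T is 2-regular without half-loops.  In that case every vertex other than the
-- base point carries a whole-loop and therefore no further edge, while following the walk from it
-- to the base point leaves it along an edge of the reduction.  So T has a single vertex, carrying
-- a single whole-loop.

module Submission where

open import Defs
open import Data.Fin using (Fin)
open import Data.List using (List; []; _∷_)
open import Data.Sum using (_⊎_)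
open import Data.Integer using (_≥_; +_)

open import Data.Nat as ℕ using (ℕ; zero; suc; _+_; _∸_; _≤_; _<_; z≤n; s≤s; _≤?_)
open import Data.Nat.Properties as ℕP using (+-mono-≤; +-mono-<-≤; +-mono-≤-<)
import Data.Integer as ℤ
import Data.Integer.Properties as ℤP
open import Data.Fin using (toℕ; punchIn) renaming (zero to fzero; suc to fsuc)
open import Data.Fin.Properties using (_≟_; any?; punchInᵢ≢i)
open import Data.Fin.Permutation using (permutation)
open import Data.List using (length; filter; allFin; tabulate; _++_)
open import Data.List.Properties using (++-assoc; length-++; ∷-injectiveˡ)
open import Data.List.Membership.Propositional using (_∈_; find)
open import Data.List.Membership.Propositional.Properties using (∈-filter⁺; ∈-filter⁻; ∈-allFin; ∈-∃++)
open import Data.List.Relation.Unary.Any as Any using (Any; here; there)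
open import Data.List.Relation.Unary.All as All using (All; []; _∷_)
open import Data.List.Relation.Unary.All.Properties using (++⁺; ++⁻ˡ; ++⁻ʳ)
open import Data.List.Relation.Unary.AllPairs using (_∷_)
open import Data.List.Relation.Unary.Unique.Propositional using (Unique)
import Data.List.Relation.Unary.Unique.Propositional.Properties as Unique
open import Data.Product using (Σ-syntax; ∃-syntax; _×_; _,_; proj₁; proj₂)
open import Data.Sum using (inj₁; inj₂)
open import Data.Unit using (tt)
open import Function using (_∘_)
open import Level using (_⊔_)
open import Relation.Nullary using (¬_; Dec; yes; no; contradiction; ¬?)
open import Relation.Nullary.Decidable using (_×-dec_)
open import Relation.Unary using (Pred; Decidable)
open import Relation.Binary.PropositionalEquality
open import Algebra.Properties.CommutativeMonoid.Sum ℕP.+-0-commutativeMonoid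
  using (sum; sum-syntax; ∑-comm; ∑-distrib-+; sum-permute; sum-remove; sum-cong-≗; sum-replicate-zero)

indicator : ∀ {p} {P : Set p} → Dec P → ℕ
indicator (yes _) = 1
indicator (no _)  = 0

indicator-yes : ∀ {p} {P : Set p} (P? : Dec P) → P → indicator P? ≡ 1
indicator-yes (yes _)  _ = refl
indicator-yes (no ¬P) P = contradiction P ¬P

indicator-no : ∀ {p} {P : Set p} (P? : Dec P) → ¬ P → indicator P? ≡ 0
indicator-no (yes P) ¬P = contradiction P ¬P
indicator-no (no _)  _  = refl

∑-mono-≤ : ∀ {n} {f g : Fin n → ℕ} → (∀ i → f i ≤ g i) → sum f ≤ sum g
∑-mono-≤ {zero}  f≤g = z≤n
∑-mono-≤ {suc n} f≤g = +-mono-≤ (f≤g fzero) (∑-mono-≤ (f≤g ∘ fsuc))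

∑-mono-< : ∀ {n} {f g : Fin n → ℕ} → (∀ i → f i ≤ g i) → ∀ j → f j < g j → sum f < sum g
∑-mono-< f≤g fzero    fj<gj = +-mono-<-≤ fj<gj (∑-mono-≤ (f≤g ∘ fsuc))
∑-mono-< f≤g (fsuc j) fj<gj = +-mono-≤-< (f≤g fzero) (∑-mono-< (f≤g ∘ fsuc) j fj<gj)

∑-ones : ∀ n → ∑[ i < n ] 1 ≡ n
∑-ones zero    = refl
∑-ones (suc n) = cong suc (∑-ones n)

∑-twos : ∀ n → ∑[ i < n ] 2 ≡ n + n
∑-twos n = trans (∑-distrib-+ {n} (λ _ → 1) (λ _ → 1)) (cong₂ _+_ (∑-ones n) (∑-ones n))

m+m<n+n⇒m<n : ∀ {m n} → m + m < n + n → m < n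
m+m<n+n⇒m<n m+m<n+n = ℕP.≰⇒> (λ n≤m → ℕP.<⇒≱ m+m<n+n (+-mono-≤ n≤m n≤m))

∑-indicator-≡ : ∀ {n} (x : Fin n) → ∑[ y < n ] indicator (x ≟ y) ≡ 1
∑-indicator-≡ {suc n} x = begin
  ∑[ y < suc n ] indicator (x ≟ y)                           ≡⟨ sum-remove {i = x} (λ y → indicator (x ≟ y)) ⟩
  indicator (x ≟ x) + ∑[ j < n ] indicator (x ≟ punchIn x j) ≡⟨ cong₂ _+_ (indicator-yes (x ≟ x) refl) (sum-cong-≗ miss) ⟩
  1 + ∑[ j < n ] 0                                           ≡⟨ cong (_+_ 1) (sum-replicate-zero n) ⟩
  1                                                          ∎
  where
  open ≡-Reasoning
  miss : ∀ j → indicator (x ≟ punchIn x j) ≡ 0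
  miss j = indicator-no (x ≟ punchIn x j) (punchInᵢ≢i x j ∘ sym)

length-filter-tabulate : ∀ {a p} {A : Set a} {P : Pred A p} (P? : Decidable P) {n} (f : Fin n → A) →
                         length (filter P? (tabulate f)) ≡ ∑[ i < n ] indicator (P? (f i))
length-filter-tabulate P? {zero}  f = refl
length-filter-tabulate P? {suc n} f with P? (f fzero)
... | yes _ = cong suc (length-filter-tabulate P? (f ∘ fsuc))
... | no _  = length-filter-tabulate P? (f ∘ fsuc)

module _ {a} {A : Set a} where

  ∈-remove : ∀ {x : A} {xs} → x ∈ xs →
             Σ[ ys ∈ List A ] length xs ≡ suc (length ys) × (∀ {z} → z ∈ xs → z ≢ x → z ∈ ys)
  ∈-remove {xs = _ ∷ ys} (here refl) = ys , refl , λ where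
    (here refl) z≢z → contradiction refl z≢z
    (there z∈ys) _  → z∈ys
  ∈-remove {xs = y ∷ _} (there x∈xs) with ∈-remove x∈xs
  ... | ys , len≡ , keep = y ∷ ys , cong suc len≡ , λ where
    (here refl) _     → here refl
    (there z∈xs) z≢x → there (keep z∈xs z≢x)

  ∈⇒1≤length : ∀ {x : A} {xs} → x ∈ xs → 1 ≤ length xs
  ∈⇒1≤length (here _)  = s≤s z≤n
  ∈⇒1≤length (there _) = s≤s z≤n

  distinct₂⇒2≤length : ∀ {x y : A} {xs} → x ∈ xs → y ∈ xs → x ≢ y → 2 ≤ length xs
  distinct₂⇒2≤length x∈ y∈ x≢y with ∈-remove x∈
  ... | _ , len≡ , keep rewrite len≡ = s≤s (∈⇒1≤length (keep y∈ (x≢y ∘ sym)))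

  distinct₃⇒3≤length : ∀ {x y z : A} {xs} → x ∈ xs → y ∈ xs → z ∈ xs →
                       x ≢ y → x ≢ z → y ≢ z → 3 ≤ length xs
  distinct₃⇒3≤length x∈ y∈ z∈ x≢y x≢z y≢z with ∈-remove x∈
  ... | _ , len≡ , keep rewrite len≡ =
    s≤s (distinct₂⇒2≤length (keep y∈ (x≢y ∘ sym)) (keep z∈ (x≢z ∘ sym)) y≢z)

  Distinct₃ : ∀ {p} → Pred A p → Set (a ⊔ p)
  Distinct₃ P = ∃[ x ] ∃[ y ] ∃[ z ] P x × P y × P z × x ≢ y × x ≢ z × y ≢ z

  unique∧3≤length⇒distinct₃ : ∀ {xs : List A} → Unique xs → 3 ≤ length xs → Distinct₃ (_∈ xs)
  unique∧3≤length⇒distinct₃ {x ∷ y ∷ z ∷ _} ((x≢y ∷ x≢z ∷ _) ∷ (y≢z ∷ _) ∷ _) _ =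
    x , y , z , here refl , there (here refl) , there (there (here refl)) , x≢y , x≢z , y≢z
  unique∧3≤length⇒distinct₃ {[]}         _ ()
  unique∧3≤length⇒distinct₃ {_ ∷ []}     _ (s≤s ())
  unique∧3≤length⇒distinct₃ {_ ∷ _ ∷ []} _ (s≤s (s≤s ()))

module _ {p} {n : ℕ} {P : Pred (Fin n) p} (P? : Decidable P) where

  count : ℕ
  count = length (filter P? (allFin n))

  count≡∑indicator : count ≡ ∑[ i < n ] indicator (P? i)
  count≡∑indicator = length-filter-tabulate P? (λ i → i)

  private
    counted : ∀ {i} → P i → i ∈ filter P? (allFin n)
    counted = ∈-filter⁺ P? (∈-allFin _)

  2≤count : ∀ {i j} → P i → P j → i ≢ j → 2 ≤ count
  2≤count Pi Pj = distinct₂⇒2≤length (counted Pi) (counted Pj)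

  3≤count : ∀ {i j k} → P i → P j → P k → i ≢ j → i ≢ k → j ≢ k → 3 ≤ count
  3≤count Pi Pj Pk = distinct₃⇒3≤length (counted Pi) (counted Pj) (counted Pk)

  3≤count⇒distinct₃ : 3 ≤ count → Distinct₃ P
  3≤count⇒distinct₃ 3≤c with unique∧3≤length⇒distinct₃ (Unique.filter⁺ P? (Unique.allFin⁺ n)) 3≤c
  ... | i , j , k , i∈ , j∈ , k∈ , distinct = i , j , k , P∈ i∈ , P∈ j∈ , P∈ k∈ , distinct
    where
    P∈ : ∀ {i} → i ∈ filter P? (allFin n) → P i
    P∈ = proj₂ ∘ ∈-filter⁻ P? {xs = allFin n}

  count≤2⇒one-of : count ≤ 2 → ∀ {i j k} → P i → P j → i ≢ j → P k → k ≡ i ⊎ k ≡ j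
  count≤2⇒one-of c≤2 {i} {j} {k} Pi Pj i≢j Pk with k ≟ i | k ≟ j
  ... | yes k≡i | _       = inj₁ k≡i
  ... | no _    | yes k≡j = inj₂ k≡j
  ... | no k≢i  | no k≢j  = contradiction (3≤count Pi Pj Pk i≢j (k≢i ∘ sym) (k≢j ∘ sym)) (ℕP.<⇒≱ (s≤s c≤2))

hd-ι : ∀ G d → hd G (ι G d) ≡ tl G d
hd-ι G d = trans (sym (tl-ι G (ι G d))) (cong (tl G) (ι-invol G d))

module _ (T : Graph) where

  degree : Fin (nV T) → ℕ
  degree y = count (λ e → tl T e ≟ y)

  HasLoop : Fin (nV T) → Set
  HasLoop y = ∃[ e ] tl T e ≡ y × hd T e ≡ y

  hasLoop? : ∀ y → Dec (HasLoop y)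
  hasLoop? y = any? (λ e → (tl T e ≟ y) ×-dec (hd T e ≟ y))

  handshake : ∑[ y < nV T ] degree y ≡ nD T
  handshake = begin
    ∑[ y < nV T ] degree y                             ≡⟨ sum-cong-≗ (λ y → count≡∑indicator (λ e → tl T e ≟ y)) ⟩
    ∑[ y < nV T ] ∑[ e < nD T ] indicator (tl T e ≟ y) ≡⟨ ∑-comm (λ y e → indicator (tl T e ≟ y)) ⟩
    ∑[ e < nD T ] ∑[ y < nV T ] indicator (tl T e ≟ y) ≡⟨ sum-cong-≗ (λ e → ∑-indicator-≡ (tl T e)) ⟩
    ∑[ e < nD T ] 1                                    ≡⟨ ∑-ones (nD T) ⟩
    nD T                                               ∎
    where open ≡-Reasoning

  private
    orbitMin : Fin (nD T) → ℕ
    orbitMin e = indicator (toℕ e ≤? toℕ (ι T e))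

    orbitMins : Fin (nD T) → ℕ
    orbitMins e = orbitMin e + orbitMin (ι T e)

    numEdges+numEdges≡∑orbitMins : numEdges T + numEdges T ≡ ∑[ e < nD T ] orbitMins e
    numEdges+numEdges≡∑orbitMins = begin
      numEdges T + numEdges T                                   ≡⟨ cong₂ _+_ E≡ (trans E≡ (sum-permute orbitMin ιᵖ)) ⟩
      ∑[ e < nD T ] orbitMin e + ∑[ e < nD T ] orbitMin (ι T e) ≡⟨ ∑-distrib-+ orbitMin (orbitMin ∘ ι T) ⟨
      ∑[ e < nD T ] orbitMins e                                 ∎
      where
      open ≡-Reasoning
      E≡ = count≡∑indicator (λ e → toℕ e ≤? toℕ (ι T e))
      ιᵖ = permutation (ι T) (ι T) (ι-invol T) (ι-invol T)

    1≤orbitMins : ∀ e → 1 ≤ orbitMins e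
    1≤orbitMins e with toℕ e ≤? toℕ (ι T e) | toℕ (ι T e) ≤? toℕ (ι T (ι T e))
    ... | yes _    | _        = s≤s z≤n
    ... | no _     | yes _    = s≤s z≤n
    ... | no e≰ιe  | no ιe≰e  =
      contradiction (subst (λ x → toℕ (ι T e) ≤ toℕ x) (sym (ι-invol T e)) (ℕP.≰⇒≥ e≰ιe)) ιe≰e

    halfLoop⇒orbitMins≡2 : ∀ {e} → ι T e ≡ e → orbitMins e ≡ 2
    halfLoop⇒orbitMins≡2 {e} ιe≡e = cong₂ _+_
      (indicator-yes (toℕ e ≤? toℕ (ι T e)) (ℕP.≤-reflexive (cong toℕ (sym ιe≡e))))
      (indicator-yes (toℕ (ι T e) ≤? toℕ (ι T (ι T e))) (ℕP.≤-reflexive (cong toℕ (trans ιe≡e (sym (ι-invol T e))))))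

  nD≤numEdges+numEdges : nD T ≤ numEdges T + numEdges T
  nD≤numEdges+numEdges = begin
    nD T                      ≡⟨ ∑-ones (nD T) ⟨
    ∑[ e < nD T ] 1           ≤⟨ ∑-mono-≤ 1≤orbitMins ⟩
    ∑[ e < nD T ] orbitMins e ≡⟨ numEdges+numEdges≡∑orbitMins ⟨
    numEdges T + numEdges T   ∎
    where open ℕP.≤-Reasoning

  halfLoop⇒nD<numEdges+numEdges : ∀ {e} → ι T e ≡ e → nD T < numEdges T + numEdges T
  halfLoop⇒nD<numEdges+numEdges {e} ιe≡e = begin-strict
    nD T                      ≡⟨ ∑-ones (nD T) ⟨
    ∑[ e < nD T ] 1           <⟨ ∑-mono-< 1≤orbitMins e (ℕP.≤-reflexive (sym (halfLoop⇒orbitMins≡2 ιe≡e))) ⟩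
    ∑[ e < nD T ] orbitMins e ≡⟨ numEdges+numEdges≡∑orbitMins ⟨
    numEdges T + numEdges T   ∎
    where open ℕP.≤-Reasoning

  nV<numEdges⇒ord≥1 : nV T < numEdges T → ord T ≥ + 1
  nV<numEdges⇒ord≥1 V<E = begin
    + 1                   ≤⟨ ℤ.+≤+ (ℕP.m<n⇒0<n∸m V<E) ⟩
    + (numEdges T ∸ nV T) ≡⟨ ℤP.⊖-≥ (ℕP.<⇒≤ V<E) ⟨
    numEdges T ℤ.⊖ nV T   ≡⟨ ℤP.m-n≡m⊖n (numEdges T) (nV T) ⟨
    ord T                 ∎
    where open ℤP.≤-Reasoning

  minDegree2⇒ord≥1 : (∀ y → 2 ≤ degree y) →
                     (∃[ y ] 3 ≤ degree y) ⊎ (∃[ e ] ι T e ≡ e) → ord T ≥ + 1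
  minDegree2⇒ord≥1 2≤deg extra = nV<numEdges⇒ord≥1 (m+m<n+n⇒m<n (case extra))
    where
    open ℕP.≤-Reasoning
    case : (∃[ y ] 3 ≤ degree y) ⊎ (∃[ e ] ι T e ≡ e) → nV T + nV T < numEdges T + numEdges T
    case (inj₁ (y , 3≤deg)) = begin-strict
      nV T + nV T              ≡⟨ ∑-twos (nV T) ⟨
      ∑[ y < nV T ] 2          <⟨ ∑-mono-< 2≤deg y 3≤deg ⟩
      ∑[ y < nV T ] degree y   ≡⟨ handshake ⟩
      nD T                     ≤⟨ nD≤numEdges+numEdges ⟩
      numEdges T + numEdges T  ∎
    case (inj₂ (e , ιe≡e)) = begin-strict
      nV T + nV T              ≡⟨ ∑-twos (nV T) ⟨
      ∑[ y < nV T ] 2          ≤⟨ ∑-mono-≤ 2≤deg ⟩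
      ∑[ y < nV T ] degree y   ≡⟨ handshake ⟩
      nD T                     <⟨ halfLoop⇒nD<numEdges+numEdges ιe≡e ⟩
      numEdges T + numEdges T  ∎

  loop⇒closed : ∀ {y ℓ e} → degree y ≤ 2 → ι T ℓ ≢ ℓ → tl T ℓ ≡ y → hd T ℓ ≡ y →
                tl T e ≡ y → hd T e ≡ y
  loop⇒closed {y} {ℓ} deg≤2 notHalf tlℓ hdℓ tle
    with count≤2⇒one-of (λ e → tl T e ≟ y) deg≤2 tlℓ (trans (tl-ι T ℓ) hdℓ) (notHalf ∘ sym) tle
  ... | inj₁ refl = hdℓ
  ... | inj₂ refl = trans (hd-ι T ℓ) tlℓ

  singleWholeLoop⇒bouquet : ∀ {x a} → (∀ y → y ≡ x) → ι T a ≢ a → (∀ e → e ≡ a ⊎ e ≡ ι T a) →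
                            GraphIso T bouquet
  singleWholeLoop⇒bouquet {x} {a} onlyVertex notHalf onlyEdges = record
    { fV = λ _ → fzero ; gV = λ _ → x ; fD = toFin2 ; gD = fromFin2
    ; gfV = λ y → sym (onlyVertex y) ; fgV = λ { fzero → refl }
    ; gfD = from-to ; fgD = to-from
    ; f-hd = λ _ → refl ; f-tl = λ _ → refl ; f-ι = to-ι }
    where
    toFin2 : Fin (nD T) → Fin 2
    toFin2 e with e ≟ a
    ... | yes _ = fzero
    ... | no _  = fsuc fzero
    fromFin2 : Fin 2 → Fin (nD T)
    fromFin2 fzero        = a
    fromFin2 (fsuc fzero) = ι T a
    from-to : ∀ e → fromFin2 (toFin2 e) ≡ e
    from-to e with e ≟ a | onlyEdges e
    ... | yes e≡a | _        = sym e≡a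
    ... | no e≢a  | inj₁ e≡a = contradiction e≡a e≢a
    ... | no _    | inj₂ e≡ιa = sym e≡ιa
    to-from : ∀ i → toFin2 (fromFin2 i) ≡ i
    to-from fzero with a ≟ a
    ... | yes _ = refl
    ... | no a≢a = contradiction refl a≢a
    to-from (fsuc fzero) with ι T a ≟ a
    ... | yes ιa≡a = contradiction ιa≡a notHalf
    ... | no _ = refl
    to-ι : ∀ e → toFin2 (ι T e) ≡ swap2 (toFin2 e)
    to-ι e with e ≟ a | ι T e ≟ a | onlyEdges e
    ... | yes refl | yes ιa≡a | _         = contradiction ιa≡a notHalf
    ... | yes _    | no _     | _         = refl
    ... | no _     | yes _    | _         = refl
    ... | no e≢a  | no _     | inj₁ e≡a  = contradiction e≡a e≢a
    ... | no _     | no ιe≢a | inj₂ refl = contradiction (ι-invol T a) ιe≢a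

module _ (G : Graph) where

  endV-++ : ∀ w xs ys → endV G w (xs ++ ys) ≡ endV G (endV G w xs) ys
  endV-++ w []       ys = refl
  endV-++ w (x ∷ xs) ys = endV-++ (hd G x) xs ys

  endV-lastOf : ∀ d xs → endV G (hd G d) xs ≡ hd G (lastOf G d xs)
  endV-lastOf d []        = refl
  endV-lastOf d (d′ ∷ xs) = endV-lastOf d′ xs

  lastOf-∈ : ∀ d xs → lastOf G d xs ∈ d ∷ xs
  lastOf-∈ d []        = here refl
  lastOf-∈ d (d′ ∷ xs) = there (lastOf-∈ d′ xs)

  IsWalk-++⁺ : ∀ {w} xs {ys} → IsWalk G w xs → IsWalk G (endV G w xs) ys → IsWalk G w (xs ++ ys)
  IsWalk-++⁺ []       _            ys-walk = ys-walk
  IsWalk-++⁺ (x ∷ xs) (tl≡ , walk) ys-walk = tl≡ , IsWalk-++⁺ xs walk ys-walk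

  IsWalk-++⁻ˡ : ∀ {w} xs {ys} → IsWalk G w (xs ++ ys) → IsWalk G w xs
  IsWalk-++⁻ˡ []       _            = tt
  IsWalk-++⁻ˡ (x ∷ xs) (tl≡ , walk) = tl≡ , IsWalk-++⁻ˡ xs walk

  IsWalk-++⁻ʳ : ∀ {w} xs {ys} → IsWalk G w (xs ++ ys) → IsWalk G (endV G w xs) ys
  IsWalk-++⁻ʳ []       walk       = walk
  IsWalk-++⁻ʳ (x ∷ xs) (_ , walk) = IsWalk-++⁻ʳ xs walk

  NonBacktracking-∷⁻ : ∀ x xs → NonBacktracking G (x ∷ xs) → NonBacktracking G xs
  NonBacktracking-∷⁻ x []      _       = tt
  NonBacktracking-∷⁻ x (_ ∷ _) (_ , nb) = nb

  NonBacktracking-++⁻ˡ : ∀ xs {ys} → NonBacktracking G (xs ++ ys) → NonBacktracking G xs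
  NonBacktracking-++⁻ˡ []            _        = tt
  NonBacktracking-++⁻ˡ (x ∷ [])      _        = tt
  NonBacktracking-++⁻ˡ (x ∷ x′ ∷ xs) (≢ι , nb) = ≢ι , NonBacktracking-++⁻ˡ (x′ ∷ xs) nb

  NonBacktracking-++⁻ʳ : ∀ xs {ys} → NonBacktracking G (xs ++ ys) → NonBacktracking G ys
  NonBacktracking-++⁻ʳ []       nb = nb
  NonBacktracking-++⁻ʳ (x ∷ xs) nb = NonBacktracking-++⁻ʳ xs (NonBacktracking-∷⁻ x (xs ++ _) nb)

  NonBacktracking-snoc : ∀ xs x y → NonBacktracking G (xs ++ x ∷ []) → y ≢ ι G x →
                         NonBacktracking G (xs ++ x ∷ y ∷ [])
  NonBacktracking-snoc []            x y _         y≢ιx = y≢ιx , tt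
  NonBacktracking-snoc (x′ ∷ [])     x y (≢ι , _)  y≢ιx = ≢ι , y≢ιx , tt
  NonBacktracking-snoc (x′ ∷ x″ ∷ xs) x y (≢ι , nb) y≢ιx = ≢ι , NonBacktracking-snoc (x″ ∷ xs) x y nb y≢ιx

  reverseWalk : List (Fin (nD G)) → List (Fin (nD G))
  reverseWalk []       = []
  reverseWalk (x ∷ xs) = reverseWalk xs ++ ι G x ∷ []

  reverseWalk-snoc : ∀ xs x → reverseWalk (xs ++ x ∷ []) ≡ ι G x ∷ reverseWalk xs
  reverseWalk-snoc []       x = refl
  reverseWalk-snoc (y ∷ xs) x = cong (_++ ι G y ∷ []) (reverseWalk-snoc xs x)

  IsWalk-reverse : ∀ {w} xs → IsWalk G w xs →
                   IsWalk G (endV G w xs) (reverseWalk xs) × endV G (endV G w xs) (reverseWalk xs) ≡ w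
  IsWalk-reverse []       _            = tt , refl
  IsWalk-reverse {w} (x ∷ xs) (tl≡ , walk) with IsWalk-reverse xs walk
  ... | rev-walk , rev-end =
    IsWalk-++⁺ (reverseWalk xs) rev-walk (trans (tl-ι G x) (sym rev-end) , tt) ,
    trans (endV-++ _ (reverseWalk xs) (ι G x ∷ [])) (trans (hd-ι G x) tl≡)

  NonBacktracking-reverse : ∀ xs → NonBacktracking G xs → NonBacktracking G (reverseWalk xs)
  NonBacktracking-reverse []            _         = tt
  NonBacktracking-reverse (x ∷ [])      _         = tt
  NonBacktracking-reverse (x ∷ x′ ∷ xs) (x′≢ιx , nb) =
    subst (NonBacktracking G) (sym (++-assoc (reverseWalk xs) (ι G x′ ∷ []) (ι G x ∷ [])))
      (NonBacktracking-snoc (reverseWalk xs) (ι G x′) (ι G x) (NonBacktracking-reverse (x′ ∷ xs) nb)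
        (λ ιx≡ιιx′ → x′≢ιx (sym (trans ιx≡ιιx′ (ι-invol G x′)))))

  All-reverseWalk : ∀ {p} {P : Pred (Fin (nD G)) p} → (∀ {d} → P d → P (ι G d)) →
                    ∀ {xs} → All P xs → All P (reverseWalk xs)
  All-reverseWalk P-ι []         = []
  All-reverseWalk P-ι (px ∷ pxs) = ++⁺ (All-reverseWalk P-ι pxs) (P-ι px ∷ [])

  entered⇒endOrLeft : ∀ {u w} x xs → IsWalk G w (x ∷ xs) → NonBacktracking G (x ∷ xs) →
                      Any (λ d → hd G d ≡ u) (x ∷ xs) →
                      hd G (lastOf G x xs) ≡ u ⊎
                      (∃[ a ] ∃[ b ] a ∈ x ∷ xs × b ∈ x ∷ xs × hd G a ≡ u × tl G b ≡ u × b ≢ ι G a)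
  entered⇒endOrLeft x []       _                   _          (here hd≡) = inj₁ hd≡
  entered⇒endOrLeft x (y ∷ ys) (_ , tly≡ , _)     (y≢ιx , _) (here hd≡) =
    inj₂ (x , y , here refl , there (here refl) , hd≡ , trans tly≡ hd≡ , y≢ιx)
  entered⇒endOrLeft x (y ∷ ys) (_ , walk)          (_ , nb)   (there entered)
    with entered⇒endOrLeft y ys walk nb entered
  ... | inj₁ last≡ = inj₁ last≡
  ... | inj₂ (a , b , a∈ , b∈ , rest) = inj₂ (a , b , there a∈ , there b∈ , rest)

module VisitedSubgraph (G : Graph) (v₀ : Fin (nV G)) (d₀ : Fin (nD G)) (ds′ : List (Fin (nD G)))
                       (snbc : IsSNBC G v₀ (d₀ ∷ ds′)) where

  open Reduction G v₀ (d₀ ∷ ds′) public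

  private
    ds : List (Fin (nD G))
    ds = d₀ ∷ ds′

  closed : vEnd ≡ v₀
  closed = proj₁ (proj₂ (proj₂ snbc))

  v₀-remaining : Remaining v₀
  v₀-remaining = inj₁ refl , λ suppressed → proj₁ (proj₂ suppressed) refl

  DS-ι : ∀ {d} → DS d → DS (ι G d)
  DS-ι (inj₁ d∈) = inj₂ (subst (_∈ ds) (sym (ι-invol G _)) d∈)
  DS-ι (inj₂ ιd∈) = inj₁ ιd∈

  visited-hd : ∀ {d} → d ∈ ds → VS (hd G d)
  visited-hd d∈ = inj₂ (Any.map (λ d≡ → cong (hd G) (sym d≡)) d∈)

  visited-tl : ∀ {d} → d ∈ ds → VS (tl G d)
  visited-tl = All.lookup (tails-visited (inj₁ refl) (proj₁ snbc) (All.tabulate (λ d∈ → d∈)))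
    where
    tails-visited : ∀ {w es} → VS w → IsWalk G w es → All (_∈ ds) es → All (λ d → VS (tl G d)) es
    tails-visited _     _            []          = []
    tails-visited w-vis (tl≡ , walk) (e∈ ∷ es∈) =
      subst VS (sym tl≡) w-vis ∷ tails-visited (visited-hd e∈) walk es∈

  DS⇒visited-hd : ∀ {d} → DS d → VS (hd G d)
  DS⇒visited-hd (inj₁ d∈)      = visited-hd d∈
  DS⇒visited-hd {d} (inj₂ ιd∈) = subst VS (tl-ι G d) (visited-tl ιd∈)

  SuppressedBead? : ∀ x → Dec (SuppressedBead x)
  SuppressedBead? x = ((degS x ℕ.≟ 2) ×-dec ¬? hasSelfLoop?) ×-dec (¬? (x ≟ v₀) ×-dec ¬? (x ≟ vEnd))
    where
    hasSelfLoop? : Dec (HasSelfLoop x)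
    hasSelfLoop? = any? (λ d → DS? d ×-dec ((tl G d ≟ x) ×-dec (hd G d ≟ x)))

  record PathToBase (w : Fin (nV G)) (es : List (Fin (nD G))) : Set where
    field
      isWalk          : IsWalk G w es
      inS             : All DS es
      nonBacktracking : NonBacktracking G es
      toBase          : endV G w es ≡ v₀
  open PathToBase

  wholeWalk : PathToBase v₀ ds
  wholeWalk = record
    { isWalk = proj₁ snbc ; inS = All.tabulate inj₁
    ; nonBacktracking = proj₁ (proj₂ snbc) ; toBase = closed }

  PathToBase-++⁻ʳ : ∀ {w} xs {ys} → PathToBase w (xs ++ ys) → PathToBase (endV G w xs) ys
  PathToBase-++⁻ʳ {w} xs path = record
    { isWalk = IsWalk-++⁻ʳ G xs (isWalk path) ; inS = ++⁻ʳ xs (inS path)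
    ; nonBacktracking = NonBacktracking-++⁻ʳ G xs (nonBacktracking path)
    ; toBase = trans (sym (endV-++ G w xs _)) (toBase path) }

  PathToBase-∷⁻ : ∀ {w x xs} → PathToBase w (x ∷ xs) → PathToBase (hd G x) xs
  PathToBase-∷⁻ {x = x} = PathToBase-++⁻ʳ (x ∷ [])

  PathToBase-tl : ∀ {w x xs} → PathToBase w (x ∷ xs) → PathToBase (tl G x) (x ∷ xs)
  PathToBase-tl path = subst (λ w → PathToBase w _) (sym (proj₁ (isWalk path))) path

  reversedPrefixToBase : ∀ xs {ys} → ds ≡ xs ++ ys → PathToBase (endV G v₀ xs) (reverseWalk G xs)
  reversedPrefixToBase xs ds≡ = record
    { isWalk = proj₁ reversed ; inS = All-reverseWalk G DS-ι (++⁻ˡ xs (inS whole))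
    ; nonBacktracking = NonBacktracking-reverse G xs (NonBacktracking-++⁻ˡ G xs (nonBacktracking whole))
    ; toBase = proj₂ reversed }
    where
    whole = subst (PathToBase v₀) ds≡ wholeWalk
    reversed = IsWalk-reverse G xs (IsWalk-++⁻ˡ G xs (isWalk whole))

  memberToBase : ∀ {d} → d ∈ ds → ∃[ es ] PathToBase (tl G d) (d ∷ es)
  memberToBase d∈ with ∈-∃++ d∈
  ... | pre , post , ds≡ = post , PathToBase-tl (PathToBase-++⁻ʳ pre (subst (PathToBase v₀) ds≡ wholeWalk))

  edgeOfS⇒pathToBase : ∀ {d} → DS d → ∃[ es ] PathToBase (tl G d) (d ∷ es)
  edgeOfS⇒pathToBase (inj₁ d∈) = memberToBase d∈
  edgeOfS⇒pathToBase {d} (inj₂ ιd∈) with ∈-∃++ ιd∈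
  ... | pre , post , ds≡ = reverseWalk G pre , PathToBase-tl (subst (PathToBase _) reversed≡ backwards)
    where
    backwards : PathToBase (endV G v₀ (pre ++ ι G d ∷ [])) (reverseWalk G (pre ++ ι G d ∷ []))
    backwards = reversedPrefixToBase (pre ++ ι G d ∷ []) (trans ds≡ (sym (++-assoc pre (ι G d ∷ []) post)))
    reversed≡ : reverseWalk G (pre ++ ι G d ∷ []) ≡ d ∷ reverseWalk G pre
    reversed≡ = trans (reverseWalk-snoc G pre (ι G d)) (cong (_∷ reverseWalk G pre) (ι-invol G d))

  -- The part of a path up to its first vertex that is not a suppressed bead: an edge of the reduction.
  record Segment (w : Fin (nV G)) (p : Fin (nD G)) (es : List (Fin (nD G))) : Set where
    field
      body rest           : List (Fin (nD G))
      split               : p ∷ es ≡ (p ∷ body) ++ rest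
      bodyWalk            : IsWalk G w (p ∷ body)
      bodyInS             : All DS (p ∷ body)
      bodyNonBacktracking : NonBacktracking G (p ∷ body)
      endRemaining        : Remaining (endV G w (p ∷ body))
      innerSuppressed     : All SuppressedBead (innerV G (p ∷ body))

    reducedEdge : Remaining w → RedEdge w (p ∷ body)
    reducedEdge w-rem = bodyWalk , bodyInS , bodyNonBacktracking , w-rem , endRemaining , innerSuppressed

    restToBase : PathToBase w (p ∷ es) → PathToBase (endV G w (p ∷ body)) rest
    restToBase path = PathToBase-++⁻ʳ (p ∷ body) (subst (PathToBase w) split path)

    rest-shorter : length rest ≤ length es
    rest-shorter = begin
      length rest               ≤⟨ ℕP.m≤n+m (length rest) (length body) ⟩
      length body + length rest ≡⟨ length-++ body ⟨
      length (body ++ rest)     ≡⟨ ℕP.suc-injective (cong length split) ⟨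
      length es                 ∎
      where open ℕP.≤-Reasoning
  open Segment

  firstSegment : ∀ {w p es} → PathToBase w (p ∷ es) → Segment w p es
  firstSegment {p = p} {es} path with SuppressedBead? (hd G p)
  ... | no notSuppressed = record
    { body = [] ; rest = es ; split = refl
    ; bodyWalk = proj₁ (isWalk path) , tt ; bodyInS = All.head (inS path) ∷ [] ; bodyNonBacktracking = tt
    ; endRemaining = DS⇒visited-hd (All.head (inS path)) , notSuppressed ; innerSuppressed = [] }
  firstSegment {es = []} path | yes suppressed = contradiction (toBase path) (proj₁ (proj₂ suppressed))
  firstSegment {p = p} {q ∷ es} path | yes suppressed = record
    { body = q ∷ body s ; rest = rest s ; split = cong (p ∷_) (split s)
    ; bodyWalk = proj₁ (isWalk path) , bodyWalk s ; bodyInS = All.head (inS path) ∷ bodyInS s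
    ; bodyNonBacktracking = proj₁ (nonBacktracking path) , bodyNonBacktracking s
    ; endRemaining = endRemaining s ; innerSuppressed = suppressed ∷ innerSuppressed s }
    where s = firstSegment (PathToBase-∷⁻ path)

  outEdge⇒reducedEdge : ∀ {u d} → Remaining u → DS d → tl G d ≡ u → ∃[ ps ] RedEdge u (d ∷ ps)
  outEdge⇒reducedEdge u-rem d∈S refl with edgeOfS⇒pathToBase d∈S
  ... | _ , path = body s , reducedEdge s u-rem
    where s = firstSegment path

  Escape : Fin (nV G) → Set
  Escape u = ∃[ ps ] RedEdge u ps × endV G u ps ≢ u

  -- n is fuel: each segment consumes at least one edge of the path.
  escape : ∀ {u} → Remaining u → u ≢ v₀ → ∀ n {es} → length es ≤ n → PathToBase u es → Escape u
  escape u-rem u≢v₀ _ {[]} _ path = contradiction (toBase path) u≢v₀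
  escape {u} u-rem u≢v₀ (suc n) {p ∷ es} (s≤s len≤n) path = continue (firstSegment path)
    where
    continue : Segment u p es → Escape u
    continue s with endV G u (p ∷ body s) ≟ u
    ... | no end≢u  = p ∷ body s , reducedEdge s u-rem , end≢u
    ... | yes end≡u = escape u-rem u≢v₀ n (ℕP.≤-trans (rest-shorter s) len≤n)
                        (subst (λ w → PathToBase w (rest s)) end≡u (restToBase s path))

  remaining⇒escape : ∀ {u} → Remaining u → u ≢ v₀ → Escape u
  remaining⇒escape {u} u-rem u≢v₀ with proj₁ u-rem
  ... | inj₁ u≡v₀ = contradiction u≡v₀ u≢v₀
  ... | inj₂ entered with find entered
  ...   | p , p∈ , hd≡u with memberToBase p∈
  ...     | post , path = escape u-rem u≢v₀ (length post) ℕP.≤-refl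
                            (subst (λ w → PathToBase w post) hd≡u (PathToBase-∷⁻ path))

  TwoOutEdges : Fin (nV G) → Set
  TwoOutEdges u = ∃[ a ] ∃[ b ] DS a × DS b × tl G a ≡ u × tl G b ≡ u × a ≢ b

  private
    hd-last≡v₀ : hd G (lastOf G d₀ ds′) ≡ v₀
    hd-last≡v₀ = trans (sym (endV-lastOf G d₀ ds′)) closed

  basepoint-twoOutEdges : TwoOutEdges v₀
  basepoint-twoOutEdges =
    d₀ , ι G (lastOf G d₀ ds′) , inj₁ (here refl) , DS-ι (inj₁ (lastOf-∈ G d₀ ds′)) ,
    proj₁ (proj₁ snbc) , trans (tl-ι G _) hd-last≡v₀ , proj₂ (proj₂ (proj₂ snbc))

  visited⇒twoOutEdges : ∀ {u} → VS u → TwoOutEdges u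
  visited⇒twoOutEdges (inj₁ refl) = basepoint-twoOutEdges
  visited⇒twoOutEdges (inj₂ entered) with entered⇒endOrLeft G d₀ ds′ (proj₁ snbc) (proj₁ (proj₂ snbc)) entered
  ... | inj₁ last≡u = subst TwoOutEdges (trans (sym hd-last≡v₀) last≡u) basepoint-twoOutEdges
  ... | inj₂ (a , b , a∈ , b∈ , hd≡u , tl≡u , b≢ιa) =
    ι G a , b , DS-ι (inj₁ a∈) , inj₁ b∈ , trans (tl-ι G a) hd≡u , tl≡u , b≢ιa ∘ sym

module HomotopyTypeOfSNBC (G : Graph) (v₀ : Fin (nV G)) (d₀ : Fin (nD G)) (ds′ : List (Fin (nD G)))
                          (snbc : IsSNBC G v₀ (d₀ ∷ ds′)) (T : Graph)
                          (I : Reduction.IsoToReduction G v₀ (d₀ ∷ ds′) T) where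

  open VisitedSubgraph G v₀ d₀ ds′ snbc
  open IsoToReduction I

  basepoint : Fin (nV T)
  basepoint = proj₁ (fV-surj v₀ v₀-remaining)

  fV≡v₀⇒basepoint : ∀ {y} → fV y ≡ v₀ → y ≡ basepoint
  fV≡v₀⇒basepoint fVy≡v₀ = fV-inj _ _ (trans fVy≡v₀ (sym (proj₂ (fV-surj v₀ v₀-remaining))))

  edge-endpoint : ∀ {e y ps} → tl T e ≡ y → fD e ≡ ps → endV G (fV y) ps ≡ fV (hd T e)
  edge-endpoint refl refl = fD-hd _

  reducedEdge⇒edge : ∀ y {ps} → RedEdge (fV y) ps → ∃[ e ] tl T e ≡ y × fD e ≡ ps
  reducedEdge⇒edge y {d ∷ ps} red with fD-surj (fV y) (d ∷ ps) red
  ... | e , fDe≡ = e , fV-inj _ _ (trans (sym tl≡) (proj₁ (proj₁ red))) , fDe≡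
    where
    tl≡ : tl G d ≡ fV (tl T e)
    tl≡ = proj₁ (proj₁ (subst (RedEdge (fV (tl T e))) fDe≡ (fD-red e)))

  outEdgeOfS⇒edge : ∀ y {a} → DS a → tl G a ≡ fV y → ∃[ e ] tl T e ≡ y × ∃[ ps ] fD e ≡ a ∷ ps
  outEdgeOfS⇒edge y a∈S tla≡ with outEdge⇒reducedEdge (fV-rem y) a∈S tla≡
  ... | ps , red with reducedEdge⇒edge y red
  ...   | e , tle≡ , fDe≡ = e , tle≡ , ps , fDe≡

  distinct-first-edges : ∀ {e e′ a b ps ps′} → fD e ≡ a ∷ ps → fD e′ ≡ b ∷ ps′ → a ≢ b → e ≢ e′
  distinct-first-edges fDe≡ fDe′≡ a≢b refl = a≢b (∷-injectiveˡ (trans (sym fDe≡) fDe′≡))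

  twoOutEdgesᵀ : ∀ y → ∃[ e ] ∃[ e′ ] tl T e ≡ y × tl T e′ ≡ y × e ≢ e′
  twoOutEdgesᵀ y with visited⇒twoOutEdges (proj₁ (fV-rem y))
  ... | a , b , a∈S , b∈S , tla , tlb , a≢b with outEdgeOfS⇒edge y a∈S tla | outEdgeOfS⇒edge y b∈S tlb
  ...   | ea , tlea , _ , fDea | eb , tleb , _ , fDeb =
    ea , eb , tlea , tleb , distinct-first-edges fDea fDeb a≢b

  2≤degree : ∀ y → 2 ≤ degree T y
  2≤degree y with twoOutEdgesᵀ y
  ... | e , e′ , tle , tle′ , e≢e′ = 2≤count (λ e → tl T e ≟ y) tle tle′ e≢e′

  degree≤2⇒degS≤2 : ∀ y → degree T y ≤ 2 → degS (fV y) ≤ 2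
  degree≤2⇒degS≤2 y deg≤2 with degS (fV y) ℕ.≤? 2
  ... | yes degS≤2 = degS≤2
  ... | no degS≰2 with 3≤count⇒distinct₃ (λ d → DS? d ×-dec (tl G d ≟ fV y)) (ℕP.≰⇒> degS≰2)
  ... | a , b , c , (a∈S , tla) , (b∈S , tlb) , (c∈S , tlc) , a≢b , a≢c , b≢c
    with outEdgeOfS⇒edge y a∈S tla | outEdgeOfS⇒edge y b∈S tlb | outEdgeOfS⇒edge y c∈S tlc
  ... | ea , tlea , _ , fDea | eb , tleb , _ , fDeb | ec , tlec , _ , fDec =
    contradiction (3≤count (λ e → tl T e ≟ y) tlea tleb tlec
                    (distinct-first-edges fDea fDeb a≢b) (distinct-first-edges fDea fDec a≢c)
                    (distinct-first-edges fDeb fDec b≢c))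
                  (ℕP.<⇒≱ (s≤s deg≤2))

  noLoop⇒noSelfLoopS : ∀ y → ¬ HasLoop T y → ¬ HasSelfLoop (fV y)
  noLoop⇒noSelfLoopS y noLoop (d , d∈S , tld , hdd) = noLoop (closeUp (reducedEdge⇒edge y loopEdge))
    where
    loopEdge : RedEdge (fV y) (d ∷ [])
    loopEdge = (tld , tt) , d∈S ∷ [] , tt , fV-rem y , subst Remaining (sym hdd) (fV-rem y) , []
    closeUp : ∃[ e ] tl T e ≡ y × fD e ≡ d ∷ [] → HasLoop T y
    closeUp (e , tle , fDe) = e , tle , fV-inj _ _ (trans (sym (edge-endpoint tle fDe)) hdd)

  unlooped⇒basepoint : ∀ y → degree T y ≤ 2 → ¬ HasLoop T y → y ≡ basepoint
  unlooped⇒basepoint y deg≤2 noLoop with fV y ≟ v₀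
  ... | yes fVy≡v₀ = fV≡v₀⇒basepoint fVy≡v₀
  ... | no fVy≢v₀  = contradiction suppressed (proj₂ (fV-rem y))
    where
    2≤degS : 2 ≤ degS (fV y)
    2≤degS with visited⇒twoOutEdges (proj₁ (fV-rem y))
    ... | a , b , a∈S , b∈S , tla , tlb , a≢b =
      2≤count (λ d → DS? d ×-dec (tl G d ≟ fV y)) (a∈S , tla) (b∈S , tlb) a≢b
    suppressed : SuppressedBead (fV y)
    suppressed = (ℕP.≤-antisym (degree≤2⇒degS≤2 y deg≤2) 2≤degS , noLoop⇒noSelfLoopS y noLoop) ,
                 fVy≢v₀ , (λ fVy≡vEnd → fVy≢v₀ (trans fVy≡vEnd closed))

  module _ (deg≤2 : ∀ y → degree T y ≤ 2) (noHalfLoop : ∀ e → ι T e ≢ e) where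

    everyVertexIsBasepoint : ∀ y → y ≡ basepoint
    everyVertexIsBasepoint y with y ≟ basepoint
    ... | yes y≡ = y≡
    ... | no y≢ with hasLoop? T y
    ...   | no noLoop = contradiction (unlooped⇒basepoint y (deg≤2 y) noLoop) y≢
    ...   | yes (ℓ , tlℓ , hdℓ) with remaining⇒escape (fV-rem y) (y≢ ∘ fV≡v₀⇒basepoint)
    ...     | ps , red , end≢ with reducedEdge⇒edge y red
    ...       | e , tle , fDe =
      contradiction (trans (edge-endpoint tle fDe) (cong fV (loop⇒closed T (deg≤2 y) (noHalfLoop ℓ) tlℓ hdℓ tle)))
                    end≢

    isBouquet : GraphIso T bouquet
    isBouquet = singleWholeLoop⇒bouquet T everyVertexIsBasepoint (noHalfLoop a) onlyEdges
      where
      a = proj₁ (twoOutEdgesᵀ basepoint)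
      atBase : ∀ e → tl T e ≡ basepoint
      atBase = everyVertexIsBasepoint ∘ tl T
      onlyEdges : ∀ e → e ≡ a ⊎ e ≡ ι T a
      onlyEdges e = count≤2⇒one-of (λ e → tl T e ≟ basepoint) (deg≤2 basepoint)
                      (atBase a) (atBase (ι T a)) (noHalfLoop a ∘ sym) (atBase e)

  dichotomy : GraphIso T bouquet ⊎ ord T ≥ + 1
  dichotomy with any? (λ y → 3 ≤? degree T y) | any? (λ e → ι T e ≟ e)
  ... | yes highDegree  | _             = inj₂ (minDegree2⇒ord≥1 T 2≤degree (inj₁ highDegree))
  ... | no _            | yes halfLoop  = inj₂ (minDegree2⇒ord≥1 T 2≤degree (inj₂ halfLoop))
  ... | no noHighDegree | no noHalfLoop = inj₁ (isBouquet deg≤2 (λ e ιe≡e → noHalfLoop (e , ιe≡e)))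
    where
    deg≤2 : ∀ y → degree T y ≤ 2
    deg≤2 y = ℕP.≤-pred (ℕP.≰⇒> (λ 3≤deg → noHighDegree (y , 3≤deg)))

corollary6p5 : (G : Graph) (v₀ : Fin (nV G)) (ds : List (Fin (nD G))) →
               IsSNBC G v₀ ds →
               (T : Graph) → HomotopyType G v₀ ds T →
               GraphIso T bouquet ⊎ ord T ≥ + 1
corollary6p5 G v₀ []         ()
corollary6p5 G v₀ (d₀ ∷ ds′) snbc T I = HomotopyTypeOfSNBC.dichotomy G v₀ d₀ ds′ snbc T I
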